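{- Let $n\ge1$ be an integer, $p\in\mathbb{C}\setminus\{0\}$, and let $f\in x+x^2\mathbb{C}[[x]]$ have the form $f(x)=x+\alpha x^{n+1}+O(x^{n+2})$ with $\alpha\neq0$. If $\mathfrak{T}f(x)=\dfrac{f(px)}{p}$, then $f(x)=x+A_1x^{n+1}+A_2x^{2n+1}+A_3x^{3n+1}+\dots$ for some $A_i\in\mathbb{C}$, i.e. the coefficient of $x^j$ in $f$ vanishes unless $j\equiv1\pmod n$.
   Context: $x+x^2\mathbb{C}[[x]]$ is the set of formal power series with zero constant term and linear coefficient 1; for $f$ in this set, $\mathfrak{T}f:=f/f'$. -}

module Defs where

open import Level using (Level; _⊔_) renaming (suc to lsuc)
open import Data.Nat using (ℕ; zero; suc; _∸_)
open import Data.Fin using (Fin; toℕ; fromℕ)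
open import Data.Vec using (Vec; []; _∷_; _∷ʳ_; lookup)
open import Algebra.Bundles using (CommutativeRing)
open import Relation.Nullary using (¬_)

record Field (c ℓ : Level) : Set (lsuc (c ⊔ ℓ)) where
  field
    commutativeRing : CommutativeRing c ℓ
  open CommutativeRing commutativeRing public
  field
    _⁻¹      : Carrier → Carrier
    ⁻¹-inverseˡ : ∀ x → ¬ (x ≈ 0#) → (x ⁻¹) * x ≈ 1#
    0≉1      : ¬ (0# ≈ 1#)

module FPS {c ℓ : Level} (F : Field c ℓ) where
  open Field F

  natC : ℕ → Carrier
  natC zero    = 0#
  natC (suc n) = 1# + natC n

  CharZero : Set ℓ
  CharZero = ∀ n → ¬ (natC (suc n) ≈ 0#)

  pow : Carrier → ℕ → Carrier
  pow x zero    = 1#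
  pow x (suc k) = x * pow x k

  -- formal power series: coefficient sequences; f k = coefficient of x^k
  Series : Set c
  Series = ℕ → Carrier

  sumFin : ∀ n → (Fin n → Carrier) → Carrier
  sumFin zero    g = 0#
  sumFin (suc n) g = g Fin.zero + sumFin n (λ i → g (Fin.suc i))
    where import Data.Fin as Fin

  mul : Series → Series → Series
  mul a b k = sumFin (suc k) (λ i → a (toℕ i) * b (k ∸ toℕ i))

  deriv : Series → Series
  deriv a k = natC (suc k) * a (suc k)

  -- multiplicative inverse of a series b with constant term 1:
  -- c₀ = 1,  c_{m} = - Σ_{i<m} b_{m-i} c_i ; invV b n = (c₀,...,cₙ)
  invV : Series → (n : ℕ) → Vec Carrier (suc n)
  invV b zero    = 1# ∷ []
  invV b (suc n) =
    let v = invV b n in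
    v ∷ʳ (- sumFin (suc n) (λ i → b (suc n ∸ toℕ i) * lookup v i))

  invS : Series → Series
  invS b n = lookup (invV b n) (fromℕ n)

  -- 𝔗 f = f / f'  (f' has constant term 1 when f ∈ x + x²K[[x]])
  𝔗 : Series → Series
  𝔗 f = mul f (invS (deriv f))

  NormalizedSeries : Series → Set ℓ
  NormalizedSeries f = (f 0 ≈ 0#) × (f 1 ≈ 1#)
    where open import Data.Product using (_×_)

  -- the series f(p x) / p, coefficientwise p^k · f_k · p⁻¹
  scaleDiv : Carrier → Series → Series
  scaleDiv p f k = (pow p k * f k) * (p ⁻¹)

module Submission where

-- Call f sparse below k (for a modulus q) if f_j = 0 for all j < k with
-- j ≢ 1 mod q.  If f is sparse below k and q ∤ k-1, then 1/f' agrees with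
-- -f' off multiples of q below k, and therefore (f/f')_k = (1-k) f_k; the
-- functional equation becomes (p^(k-1) + (k-1)) f_k = 0.  At k = n+1, with
-- modulus n+1, this gives p^n = -n because f_{n+1} ≠ 0.  At any larger
-- k ≢ 1 mod n, f_k ≠ 0 would give p^M = -M for M = k-1, hence
-- (n^M)² = (M^n)² in ℕ, and a gcd argument shows this forces n ∣ M, which is
-- false.  So, by induction on k, f is sparse below every k for the modulus n.

open import Defs
open import Level using (Level)
open import Data.Nat using (ℕ; suc; _≤_; NonZero)
open import Data.Nat.DivMod using (_%_)
open import Relation.Binary.PropositionalEquality using (_≡_)
open import Relation.Nullary using (¬_)

module Arithmetic where
  open import Data.Nat
  open import Data.Nat.Properties
  open import Data.Nat.Divisibility
  open import Data.Nat.DivMod using ([m+kn]%n≡m%n)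
  open import Data.Nat.GCD using (GCD; gcd; gcd[m,n]∣m; gcd[m,n]∣n; gcd[m,n]≢0; gcd-GCD; GCD-*)
  open import Data.Nat.Coprimality using (Coprime; coprime-divisor; GCD≡1⇒coprime)
  open import Algebra.Properties.CommutativeSemigroup *-commutativeSemigroup using (x∙yz≈y∙xz)
  open import Data.Sum using (inj₁)
  open import Relation.Binary.PropositionalEquality

  ^-distribʳ-* : ∀ a b e → (a * b) ^ e ≡ a ^ e * b ^ e
  ^-distribʳ-* a b zero    = refl
  ^-distribʳ-* a b (suc e) =
    trans (cong (a * b *_) (^-distribʳ-* a b e)) ([m*n]*[o*p]≡[m*o]*[n*p] a b (a ^ e) (b ^ e))

  coprime-∣-^⇒≡1 : ∀ {a b} e → Coprime a b → a ∣ b ^ e → a ≡ 1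
  coprime-∣-^⇒≡1 zero    _   a∣1   = ∣1⇒≡1 a∣1
  coprime-∣-^⇒≡1 (suc e) a⊥b a∣b^e = coprime-∣-^⇒≡1 e a⊥b (coprime-divisor a⊥b a∣b^e)

  -- If (a d)^M = (b d)^N with N ≤ M, 0 < M, d ≠ 0 and a, b coprime, then
  -- a = 1: cancelling d^N leaves a^M d^(M-N) = b^N, so a divides a power of b.
  cancel-common-factor : ∀ a b d N M .{{_ : NonZero d}} .{{_ : NonZero M}} → Coprime a b → N ≤ M →
                         (a * d) ^ M ≡ (b * d) ^ N → a ≡ 1
  cancel-common-factor a b d N (suc M′) a⊥b N≤M eq =
    coprime-∣-^⇒≡1 N a⊥b (subst (a ∣_) cancelled (∣m⇒∣m*n (d ^ (M ∸ N)) (m∣m*n (a ^ M′))))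
    where
      M : ℕ
      M = suc M′
      instance
        dᴺ≢0 : NonZero (d ^ N)
        dᴺ≢0 = m^n≢0 d N
      cancelled : a ^ M * d ^ (M ∸ N) ≡ b ^ N
      cancelled = *-cancelˡ-≡ _ _ (d ^ N) (begin
        d ^ N * (a ^ M * d ^ (M ∸ N))  ≡⟨ x∙yz≈y∙xz (d ^ N) (a ^ M) (d ^ (M ∸ N)) ⟩
        a ^ M * (d ^ N * d ^ (M ∸ N))  ≡⟨ cong (a ^ M *_) (sym (^-distribˡ-+-* d N (M ∸ N))) ⟩
        a ^ M * d ^ (N + (M ∸ N))      ≡⟨ cong (λ e → a ^ M * d ^ e) (m+[n∸m]≡n N≤M) ⟩
        a ^ M * d ^ M                  ≡⟨ sym (^-distribʳ-* a d M) ⟩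
        (a * d) ^ M                    ≡⟨ eq ⟩
        (b * d) ^ N                    ≡⟨ ^-distribʳ-* b d N ⟩
        b ^ N * d ^ N                  ≡⟨ *-comm (b ^ N) (d ^ N) ⟩
        d ^ N * b ^ N                  ∎)
        where open ≡-Reasoning

  -- If n^M and M^n have equal e-th powers (e > 0) and 0 < n ≤ M, then n ∣ M:
  -- with g = gcd n M, n = a g and M = b g for coprime a, b, and the
  -- hypothesis reads (a g)^(M e) = (b g)^(n e), which forces a = 1.
  swapped-powers⇒∣ : ∀ n M e .{{_ : NonZero n}} .{{_ : NonZero e}} →
                     n ≤ M → (n ^ M) ^ e ≡ (M ^ n) ^ e → n ∣ M
  swapped-powers⇒∣ n M e n≤M eq
    with divides a n≡ag ← gcd[m,n]∣m n M | divides b M≡bg ← gcd[m,n]∣n n M =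
    subst (_∣ M) (sym n≡g) (gcd[m,n]∣n n M)
    where
      g : ℕ
      g = gcd n M
      instance
        g≢0 : NonZero g
        g≢0 = ≢-nonZero (gcd[m,n]≢0 n M (inj₁ (≢-nonZero⁻¹ n)))
        M≢0 : NonZero M
        M≢0 = >-nonZero (<-≤-trans (>-nonZero⁻¹ n) n≤M)
        Me≢0 : NonZero (M * e)
        Me≢0 = m*n≢0 M e
      a⊥b : Coprime a b
      a⊥b = GCD≡1⇒coprime (GCD-* (subst (GCD (a * g) (b * g)) (sym (*-identityˡ g))
              (subst₂ (λ x y → GCD x y g) n≡ag M≡bg (gcd-GCD n M))))
      eq′ : (a * g) ^ (M * e) ≡ (b * g) ^ (n * e)
      eq′ = begin
        (a * g) ^ (M * e) ≡⟨ cong (λ x → x ^ (M * e)) n≡ag ⟨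
        n ^ (M * e)       ≡⟨ ^-*-assoc n M e ⟨
        (n ^ M) ^ e       ≡⟨ eq ⟩
        (M ^ n) ^ e       ≡⟨ ^-*-assoc M n e ⟩
        M ^ (n * e)       ≡⟨ cong (λ x → x ^ (n * e)) M≡bg ⟩
        (b * g) ^ (n * e) ∎
        where open ≡-Reasoning
      n≡g : n ≡ g
      n≡g = trans n≡ag (trans (cong (_* g) (cancel-common-factor a b g (n * e) (M * e) a⊥b (*-monoˡ-≤ e n≤M) eq′)) (*-identityˡ g))

  ∣⇒suc≡1-mod : ∀ n .{{_ : NonZero n}} {i} → n ∣ i → suc i % n ≡ 1 % n
  ∣⇒suc≡1-mod n (divides q refl) = [m+kn]%n≡m%n 1 q n

  -- If q ∤ m+1 and q ∣ n+1 with n ≤ m, then q ∤ m - n, since (m - n) + (n+1) = m+1.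
  ∤-complement : ∀ {q m n} → n ≤ m → ¬ q ∣ suc m → q ∣ suc n → ¬ q ∣ (m ∸ n)
  ∤-complement {q} {m} {n} n≤m q∤1+m q∣1+n q∣m∸n =
    q∤1+m (subst (q ∣_) m∸n+1+n≡1+m (∣m∣n⇒∣m+n q∣m∸n q∣1+n))
    where
      m∸n+1+n≡1+m : m ∸ n + suc n ≡ suc m
      m∸n+1+n≡1+m = trans (+-suc (m ∸ n) n) (cong suc (m∸n+n≡m n≤m))

module VectorLookup where
  open import Data.Nat using (zero)
  open import Data.Fin using (Fin; fromℕ; inject₁)
  open import Data.Vec using (Vec; []; _∷_; _∷ʳ_; lookup)
  open import Data.Product using (∃; _,_)
  open import Data.Sum using (_⊎_; inj₁; inj₂)
  open import Relation.Binary.PropositionalEquality using (refl; cong)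

  last-or-inject₁ : ∀ {n} (i : Fin (suc n)) → i ≡ fromℕ n ⊎ ∃ λ j → i ≡ inject₁ j
  last-or-inject₁ {zero}  Fin.zero    = inj₁ refl
  last-or-inject₁ {suc n} Fin.zero    = inj₂ (Fin.zero , refl)
  last-or-inject₁ {suc n} (Fin.suc i) with last-or-inject₁ i
  ... | inj₁ i≡last    = inj₁ (cong Fin.suc i≡last)
  ... | inj₂ (j , i≡j) = inj₂ (Fin.suc j , cong Fin.suc i≡j)

  lookup-∷ʳ-last : ∀ {a} {A : Set a} {n} (v : Vec A n) x → lookup (v ∷ʳ x) (fromℕ n) ≡ x
  lookup-∷ʳ-last []      x = refl
  lookup-∷ʳ-last (_ ∷ v) x = lookup-∷ʳ-last v x

  lookup-∷ʳ-inject₁ : ∀ {a} {A : Set a} {n} (v : Vec A n) x i → lookup (v ∷ʳ x) (inject₁ i) ≡ lookup v i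
  lookup-∷ʳ-inject₁ (_ ∷ v) x Fin.zero    = refl
  lookup-∷ʳ-inject₁ (_ ∷ v) x (Fin.suc i) = lookup-∷ʳ-inject₁ v x i

module FieldFacts {a ℓ : Level} (F : Field a ℓ) where
  open Field F
  open FPS F
  open import Data.Nat as ℕ using (zero)
  import Data.Nat.Properties as ℕ
  open import Data.Empty using (⊥-elim)
  open import Relation.Binary.PropositionalEquality as ≡ using ()
  open import Relation.Binary.Reasoning.Setoid setoid
  open import Algebra.Properties.Ring ring using (+-cancelˡ; +-inverseˡ-unique; -‿distribˡ-*; -‿distribʳ-*; -‿involutive)
  open import Algebra.Properties.Semiring.Exp semiring using (_^_; ^-congˡ; ^-assocʳ)
  open import Algebra.Properties.Semiring.Mult semiring using (_×_; ×1-homo-*)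

  nonzero-cancel : ∀ {x y} → ¬ x ≈ 0# → x * y ≈ 0# → y ≈ 0#
  nonzero-cancel {x} {y} x≉0 xy≈0 = begin
    y                ≈⟨ *-identityˡ y ⟨
    1# * y           ≈⟨ *-congʳ (⁻¹-inverseˡ x x≉0) ⟨
    (x ⁻¹ * x) * y   ≈⟨ *-assoc (x ⁻¹) x y ⟩
    x ⁻¹ * (x * y)   ≈⟨ *-congˡ xy≈0 ⟩
    x ⁻¹ * 0#        ≈⟨ zeroʳ (x ⁻¹) ⟩
    0#               ∎

  -- The relation P x = -(N x) says (P + N) x = 0; in a field it therefore
  -- forces P = -N when x ≠ 0, and x = 0 when P ≠ -N.
  annihilates : ∀ {P N x} → P * x ≈ - (N * x) → (P + N) * x ≈ 0#
  annihilates {P} {N} {x} Px≈-Nx = trans (distribʳ x P N) (trans (+-congʳ Px≈-Nx) (-‿inverseˡ (N * x)))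

  nonzero⇒P≈-N : ∀ {P N x} → P * x ≈ - (N * x) → ¬ x ≈ 0# → P ≈ - N
  nonzero⇒P≈-N {P} {N} {x} Px≈-Nx x≉0 =
    +-inverseˡ-unique P N (nonzero-cancel x≉0 (trans (*-comm x (P + N)) (annihilates Px≈-Nx)))

  P≉-N⇒zero : ∀ {P N x} → P * x ≈ - (N * x) → ¬ P ≈ - N → x ≈ 0#
  P≉-N⇒zero {P} {N} Px≈-Nx P≉-N =
    nonzero-cancel (λ P+N≈0 → P≉-N (+-inverseˡ-unique P N P+N≈0)) (annihilates Px≈-Nx)

  scaleDiv-suc : ∀ {p} → ¬ p ≈ 0# → ∀ f M → scaleDiv p f (suc M) ≈ pow p M * f (suc M)
  scaleDiv-suc {p} p≉0 f M = begin
    ((p * pow p M) * x) * p ⁻¹   ≈⟨ *-congʳ (*-assoc p (pow p M) x) ⟩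
    (p * (pow p M * x)) * p ⁻¹   ≈⟨ *-comm _ (p ⁻¹) ⟩
    p ⁻¹ * (p * (pow p M * x))   ≈⟨ *-assoc (p ⁻¹) p _ ⟨
    (p ⁻¹ * p) * (pow p M * x)   ≈⟨ *-congʳ (⁻¹-inverseˡ p p≉0) ⟩
    1# * (pow p M * x)           ≈⟨ *-identityˡ _ ⟩
    pow p M * x                  ∎
    where
      x : Carrier
      x = f (suc M)

  pow≡^ : ∀ x e → pow x e ≡ x ^ e
  pow≡^ x zero    = ≡.refl
  pow≡^ x (suc e) = ≡.cong (x *_) (pow≡^ x e)

  natC≡× : ∀ n → natC n ≡ n × 1#
  natC≡× zero    = ≡.refl
  natC≡× (suc n) = ≡.cong (1# +_) (natC≡× n)

  pow-cong : ∀ {x y} e → x ≈ y → pow x e ≈ pow y e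
  pow-cong {x} {y} e x≈y = begin
    pow x e   ≡⟨ pow≡^ x e ⟩
    x ^ e     ≈⟨ ^-congˡ e x≈y ⟩
    y ^ e     ≡⟨ pow≡^ y e ⟨
    pow y e   ∎

  pow-swap : ∀ x a b → pow (pow x a) b ≈ pow (pow x b) a
  pow-swap x a b = begin
    pow (pow x a) b   ≡⟨ ≡.trans (pow≡^ (pow x a) b) (≡.cong (_^ b) (pow≡^ x a)) ⟩
    (x ^ a) ^ b       ≈⟨ ^-assocʳ x a b ⟩
    x ^ (a ℕ.* b)     ≡⟨ ≡.cong (x ^_) (ℕ.*-comm a b) ⟩
    x ^ (b ℕ.* a)     ≈⟨ ^-assocʳ x b a ⟨
    (x ^ b) ^ a       ≡⟨ ≡.trans (pow≡^ (pow x b) a) (≡.cong (_^ a) (pow≡^ x b)) ⟨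
    pow (pow x b) a   ∎

  square-of-pow-neg : ∀ x e → pow (pow (- x) e) 2 ≈ pow (pow x e) 2
  square-of-pow-neg x e = begin
    pow (pow (- x) e) 2   ≈⟨ pow-swap (- x) e 2 ⟩
    pow (pow (- x) 2) e   ≈⟨ pow-cong e (*-congˡ (*-identityʳ (- x))) ⟩
    pow (- x * - x) e     ≈⟨ pow-cong e neg-square ⟩
    pow (x * x) e         ≈⟨ pow-cong e (*-congˡ (*-identityʳ x)) ⟨
    pow (pow x 2) e       ≈⟨ pow-swap x 2 e ⟩
    pow (pow x e) 2       ∎
    where
      neg-square : - x * - x ≈ x * x
      neg-square = begin
        - x * - x       ≈⟨ -‿distribʳ-* (- x) x ⟨
        - (- x * x)     ≈⟨ -‿cong (-‿distribˡ-* x x) ⟨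
        - - (x * x)     ≈⟨ -‿involutive (x * x) ⟩
        x * x           ∎

  natC-* : ∀ m n → natC (m ℕ.* n) ≈ natC m * natC n
  natC-* m n = begin
    natC (m ℕ.* n)          ≡⟨ natC≡× (m ℕ.* n) ⟩
    (m ℕ.* n) × 1#          ≈⟨ ×1-homo-* m n ⟩
    (m × 1#) * (n × 1#)     ≡⟨ ≡.cong₂ _*_ (natC≡× m) (natC≡× n) ⟨
    natC m * natC n         ∎

  natC-^ : ∀ m e → pow (natC m) e ≈ natC (m ℕ.^ e)
  natC-^ m zero    = sym (+-identityʳ 1#)
  natC-^ m (suc e) = trans (*-congˡ (natC-^ m e)) (sym (natC-* m (m ℕ.^ e)))

  natC-injective : CharZero → ∀ m n → natC m ≈ natC n → m ≡ n
  natC-injective char0 zero    zero    _ = ≡.refl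
  natC-injective char0 zero    (suc n) e = ⊥-elim (char0 n (sym e))
  natC-injective char0 (suc m) zero    e = ⊥-elim (char0 m e)
  natC-injective char0 (suc m) (suc n) e = ≡.cong suc (natC-injective char0 m n (+-cancelˡ 1# (natC m) (natC n) e))

  -- If p^n = -n and p^M = -M in characteristic zero, then (n^M)² = (M^n)²,
  -- both being the image of (p^(nM))².
  powers-of-negatives : CharZero → ∀ {p} n M → pow p n ≈ - natC n → pow p M ≈ - natC M →
                        (n ℕ.^ M) ℕ.^ 2 ≡ (M ℕ.^ n) ℕ.^ 2
  powers-of-negatives char0 {p} n M pⁿ≈-n pᴹ≈-M = natC-injective char0 _ _ (begin
    natC ((n ℕ.^ M) ℕ.^ 2)     ≈⟨ trans (pow-cong 2 (natC-^ n M)) (natC-^ (n ℕ.^ M) 2) ⟨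
    pow (pow (natC n) M) 2     ≈⟨ square-of-pow-neg (natC n) M ⟨
    pow (pow (- natC n) M) 2   ≈⟨ pow-cong 2 (pow-cong M pⁿ≈-n) ⟨
    pow (pow (pow p n) M) 2    ≈⟨ pow-cong 2 (pow-swap p n M) ⟩
    pow (pow (pow p M) n) 2    ≈⟨ pow-cong 2 (pow-cong n pᴹ≈-M) ⟩
    pow (pow (- natC M) n) 2   ≈⟨ square-of-pow-neg (natC M) n ⟩
    pow (pow (natC M) n) 2     ≈⟨ trans (pow-cong 2 (natC-^ M n)) (natC-^ (M ℕ.^ n) 2) ⟩
    natC ((M ℕ.^ n) ℕ.^ 2)     ∎)

module SeriesFacts {a ℓ : Level} (F : Field a ℓ) where
  open Field F
  open FPS F
  open Arithmetic using (∤-complement)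
  open VectorLookup
  open import Data.Nat as ℕ using (zero; _∸_; _<_; z≤n; s≤s)
  import Data.Nat.Properties as ℕ
  open import Data.Nat.Divisibility using (_∣_; _∣?_; _∣0)
  open import Data.Fin using (Fin; toℕ)
  import Data.Fin.Properties as Fin
  open import Data.Vec using (lookup)
  open import Data.Product using (_,_)
  open import Data.Sum using (inj₁; inj₂)
  open import Relation.Binary.PropositionalEquality as ≡ using ()
  open import Relation.Nullary using (yes; no; contradiction)
  open import Relation.Binary.Reasoning.Setoid setoid
  open import Algebra.Properties.Ring ring using (-0#≈0#; -‿+-comm)

  -- Finite sums Σ_{i<m} h i of ℕ-indexed terms; by definition of sumFin,
  -- ∑< (suc m) h unfolds to h 0 + ∑< m (h ∘ suc), and mul a b k is
  -- ∑< (suc k) (λ i → a i * b (k ∸ i)).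
  ∑< : ℕ → (ℕ → Carrier) → Carrier
  ∑< m h = sumFin m (λ i → h (toℕ i))

  ∑<-vanishing : ∀ m {h} → (∀ i → i < m → h i ≈ 0#) → ∑< m h ≈ 0#
  ∑<-vanishing zero    _      = refl
  ∑<-vanishing (suc m) h≈0 =
    trans (+-cong (h≈0 0 (s≤s z≤n)) (∑<-vanishing m (λ i i<m → h≈0 (suc i) (s≤s i<m)))) (+-identityʳ 0#)

  ∑<-last : ∀ m h → ∑< (suc m) h ≈ ∑< m h + h m
  ∑<-last zero    h = +-comm (h 0) 0#
  ∑<-last (suc m) h = trans (+-congˡ (∑<-last m (λ i → h (suc i)))) (sym (+-assoc _ _ _))

  lookup-invV : ∀ b n (i : Fin (suc n)) → lookup (invV b n) i ≡ invS b (toℕ i)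
  lookup-invV b zero    Fin.zero = ≡.refl
  lookup-invV b (suc n) i with last-or-inject₁ i
  ... | inj₁ ≡.refl       = ≡.cong (invS b) (≡.sym (Fin.toℕ-fromℕ (suc n)))
  ... | inj₂ (j , ≡.refl) = ≡.trans (lookup-∷ʳ-inject₁ (invV b n) _ j)
    (≡.trans (lookup-invV b n j) (≡.cong (invS b) (≡.sym (Fin.toℕ-inject₁ j))))

  sumFin-cong : ∀ m {g h : Fin m → Carrier} → (∀ i → g i ≈ h i) → sumFin m g ≈ sumFin m h
  sumFin-cong zero    _   = refl
  sumFin-cong (suc m) g≈h = +-cong (g≈h Fin.zero) (sumFin-cong m (λ i → g≈h (Fin.suc i)))

  invS-suc : ∀ b t → invS b (suc t) ≈ - ∑< (suc t) (λ s → b (suc t ∸ s) * invS b s)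
  invS-suc b t = begin
    invS b (suc t)                                                       ≡⟨ lookup-∷ʳ-last (invV b t) _ ⟩
    - sumFin (suc t) (λ i → b (suc t ∸ toℕ i) * lookup (invV b t) i)     ≈⟨ -‿cong (sumFin-cong (suc t) λ i →
                                                                              reflexive (≡.cong (b (suc t ∸ toℕ i) *_) (lookup-invV b t i))) ⟩
    - ∑< (suc t) (λ s → b (suc t ∸ s) * invS b s)                        ∎

  invS-sparse : ∀ q N b → (∀ s → s < N → ¬ q ∣ s → b s ≈ 0#) →
                ∀ t → t ≤ N → ¬ q ∣ t → invS b t ≈ - b t
  invS-sparse q zero    b b≈0 zero z≤n q∤0 = contradiction (q ∣0) q∤0
  invS-sparse q (suc N) b b≈0 = up-to-1+N
    where
      invS-below : ∀ t → t ≤ N → ¬ q ∣ t → invS b t ≈ - b t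
      invS-below = invS-sparse q N b (λ s s<N → b≈0 s (ℕ.m≤n⇒m≤1+n s<N))

      -- each term b_{N-s} c_{s+1} of the recursion for c_{N+1} vanishes: by the
      -- gap of b if q ∣ s+1, and otherwise because c_{s+1} = -b_{s+1} = 0
      term≈0 : ¬ q ∣ suc N → ∀ s → s < N → b (N ∸ s) * invS b (suc s) ≈ 0#
      term≈0 q∤1+N s s<N with q ∣? suc s
      ... | yes q∣1+s = trans (*-congʳ bₙ₋ₛ≈0) (zeroˡ _)
        where
          bₙ₋ₛ≈0 : b (N ∸ s) ≈ 0#
          bₙ₋ₛ≈0 = b≈0 (N ∸ s) (s≤s (ℕ.m∸n≤m N s)) (∤-complement (ℕ.<⇒≤ s<N) q∤1+N q∣1+s)
      ... | no  q∤1+s = trans (*-congˡ c₁₊ₛ≈0) (zeroʳ _)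
        where
          c₁₊ₛ≈0 : invS b (suc s) ≈ 0#
          c₁₊ₛ≈0 = trans (invS-below (suc s) s<N q∤1+s) (trans (-‿cong (b≈0 (suc s) (s≤s s<N) q∤1+s)) -0#≈0#)

      at-1+N : ¬ q ∣ suc N → invS b (suc N) ≈ - b (suc N)
      at-1+N q∤1+N = begin
        invS b (suc N)                                                  ≈⟨ invS-suc b N ⟩
        - (b (suc N) * 1# + ∑< N (λ s → b (N ∸ s) * invS b (suc s)))  ≈⟨ -‿cong (+-cong (*-identityʳ _) (∑<-vanishing N (term≈0 q∤1+N))) ⟩
        - (b (suc N) + 0#)                                              ≈⟨ -‿cong (+-identityʳ _) ⟩
        - b (suc N)                                                     ∎

      up-to-1+N : ∀ t → t ≤ suc N → ¬ q ∣ t → invS b t ≈ - b t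
      up-to-1+N t t≤1+N q∤t with ℕ.m≤n⇒m<n∨m≡n t≤1+N
      ... | inj₁ t<1+N  = invS-below t (ℕ.s≤s⁻¹ t<1+N) q∤t
      ... | inj₂ ≡.refl = at-1+N q∤t

  SparseBelow : ℕ → ℕ → Series → Set ℓ
  SparseBelow q k f = ∀ j → j < k → ¬ q ∣ (j ∸ 1) → f j ≈ 0#

  one-minus-suc : ∀ M x → - (natC (suc M) * x) + x ≈ - (natC M * x)
  one-minus-suc M x = begin
    - ((1# + natC M) * x) + x         ≈⟨ +-congʳ (-‿cong (trans (distribʳ x 1# (natC M)) (+-congʳ (*-identityˡ x)))) ⟩
    - (x + natC M * x) + x            ≈⟨ +-congʳ (sym (-‿+-comm x (natC M * x))) ⟩
    (- x + - (natC M * x)) + x        ≈⟨ +-congʳ (+-comm (- x) _) ⟩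
    (- (natC M * x) + - x) + x        ≈⟨ +-assoc _ (- x) x ⟩
    - (natC M * x) + (- x + x)        ≈⟨ +-congˡ (-‿inverseˡ x) ⟩
    - (natC M * x) + 0#               ≈⟨ +-identityʳ _ ⟩
    - (natC M * x)                    ∎

  -- If f is normalised and sparse below k = m+2 for the
  -- modulus q, and q ∤ k-1, then c = 1/f' agrees with -f' off multiples of q
  -- up to index k-1, and the only surviving terms of (f c)_k are
  -- f₁ c_{k-1} = -k f_k and f_k c₀ = f_k; hence (f/f')_k = (1-k) f_k.
  𝔗-coefficient : ∀ q m f → NormalizedSeries f → SparseBelow q (suc (suc m)) f → ¬ q ∣ suc m →
                  𝔗 f (suc (suc m)) ≈ - (natC (suc m) * f (suc (suc m)))
  𝔗-coefficient q m f (f₀≈0 , f₁≈1) f-sparse q∤1+m = begin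
    𝔗 f k                                          ≡⟨⟩
    f 0 * c k + (f 1 * c (suc m) + ∑< (suc m) g)   ≈⟨ +-cong (trans (*-congʳ f₀≈0) (zeroˡ _))
                                                        (+-cong (trans (*-congʳ f₁≈1) (*-identityˡ _)) (∑<-last m g)) ⟩
    0# + (c (suc m) + (∑< m g + g m))              ≈⟨ +-identityˡ _ ⟩
    c (suc m) + (∑< m g + g m)                     ≈⟨ +-cong (c-sparse (suc m) ℕ.≤-refl q∤1+m) (+-cong (∑<-vanishing m g-middle) g-last) ⟩
    - (natC k * f k) + (0# + f k)                  ≈⟨ +-congˡ (+-identityˡ _) ⟩
    - (natC k * f k) + f k                         ≈⟨ one-minus-suc (suc m) (f k) ⟩
    - (natC (suc m) * f k)                         ∎
    where
      k : ℕ
      k = suc (suc m)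
      c : Series
      c = invS (deriv f)
      -- the terms f_i c_{k-i} for 2 ≤ i ≤ k, reindexed from 0
      g : ℕ → Carrier
      g i = f (suc (suc i)) * c (m ∸ i)

      f′-sparse : ∀ s → s < suc m → ¬ q ∣ s → deriv f s ≈ 0#
      f′-sparse s s<1+m q∤s = trans (*-congˡ (f-sparse (suc s) (s≤s s<1+m) q∤s)) (zeroʳ _)

      c-sparse : ∀ t → t ≤ suc m → ¬ q ∣ t → c t ≈ - deriv f t
      c-sparse = invS-sparse q (suc m) (deriv f) f′-sparse

      -- for i < m either f_{i+2} = 0 (q ∤ i+1), or q ∤ m-i and c_{m-i} = 0
      g-middle : ∀ i → i < m → g i ≈ 0#
      g-middle i i<m with q ∣? suc i
      ... | no  q∤1+i = trans (*-congʳ (f-sparse (suc (suc i)) (s≤s (s≤s i<m)) q∤1+i)) (zeroˡ _)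
      ... | yes q∣1+i = trans (*-congˡ cₘ₋ᵢ≈0) (zeroʳ _)
        where
          m∸i≤m : m ∸ i ≤ m
          m∸i≤m = ℕ.m∸n≤m m i
          q∤m∸i : ¬ q ∣ (m ∸ i)
          q∤m∸i = ∤-complement (ℕ.<⇒≤ i<m) q∤1+m q∣1+i
          cₘ₋ᵢ≈0 : c (m ∸ i) ≈ 0#
          cₘ₋ᵢ≈0 = trans (c-sparse (m ∸ i) (ℕ.m≤n⇒m≤1+n m∸i≤m) q∤m∸i)
                         (trans (-‿cong (f′-sparse (m ∸ i) (s≤s m∸i≤m) q∤m∸i)) -0#≈0#)

      g-last : g m ≈ f k
      g-last = trans (*-congˡ (reflexive (≡.cong c (ℕ.n∸n≡0 m)))) (*-identityʳ (f k))

module MainArgument {a ℓ : Level} (F : Field a ℓ) where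
  open Field F
  open FPS F
  open FieldFacts F
  open SeriesFacts F
  open Arithmetic using (swapped-powers⇒∣; ∣⇒suc≡1-mod)
  open import Data.Nat as ℕ using (zero; _∸_; z≤n; s≤s)
  import Data.Nat.Properties as ℕ
  open import Data.Nat.Divisibility using (_∣_; _∣0; >⇒∤)
  open import Data.Product using (proj₁)
  open import Data.Sum using (inj₁; inj₂)
  open import Relation.Binary.PropositionalEquality using (refl)
  open import Relation.Nullary using (yes; no; contradiction)

  module _ (char0 : CharZero) (n′ : ℕ) {p : Carrier} (p≉0 : ¬ p ≈ 0#) {f : Series}
           (norm : NormalizedSeries f) (low : ∀ j → 2 ≤ j → j ≤ suc n′ → f j ≈ 0#)
           (f₁₊ₙ≉0 : ¬ f (suc (suc n′)) ≈ 0#) (eqn : ∀ k → 𝔗 f k ≈ scaleDiv p f k) where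

    n : ℕ
    n = suc n′

    coefficient-relation : ∀ q m → SparseBelow q (suc (suc m)) f → ¬ q ∣ suc m →
                           pow p (suc m) * f (suc (suc m)) ≈ - (natC (suc m) * f (suc (suc m)))
    coefficient-relation q m sparse q∤1+m =
      trans (sym (scaleDiv-suc p≉0 f (suc m))) (trans (sym (eqn _)) (𝔗-coefficient q m f norm sparse q∤1+m))

    -- p^n = -n: below n+1 the only nonzero coefficient is f₁, so f is sparse
    -- below n+1 for the modulus n+1, which does not divide n.
    pⁿ≈-n : pow p n ≈ - natC n
    pⁿ≈-n = nonzero⇒P≈-N (coefficient-relation (suc n) n′ sparse-below-n+1 (>⇒∤ (ℕ.n<1+n n))) f₁₊ₙ≉0
      where
        sparse-below-n+1 : SparseBelow (suc n) (suc n) f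
        sparse-below-n+1 zero          _     _   = proj₁ norm
        sparse-below-n+1 (suc zero)    _     n∤0 = contradiction (suc n ∣0) n∤0
        sparse-below-n+1 (suc (suc i)) i+2<n+1 _ = low (suc (suc i)) (s≤s (s≤s z≤n)) (ℕ.s≤s⁻¹ i+2<n+1)

    -- Inductive step: if f is sparse below k and k ≢ 1 mod n, then f_k = 0.
    -- For k > n, f_k ≠ 0 would give p^(k-1) = -(k-1), and with p^n = -n the
    -- power equation would force n ∣ k-1.
    next-vanishes : ∀ k → SparseBelow n k f → ¬ n ∣ (k ∸ 1) → f k ≈ 0#
    next-vanishes zero          _      _     = proj₁ norm
    next-vanishes (suc zero)    _      n∤0   = contradiction (n ∣0) n∤0
    next-vanishes (suc (suc m)) sparse n∤1+m with suc (suc m) ℕ.≤? n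
    ... | yes k≤n = low (suc (suc m)) (s≤s (s≤s z≤n)) k≤n
    ... | no  k≰n = P≉-N⇒zero (coefficient-relation n m sparse n∤1+m) pᴹ≉-M
      where
        pᴹ≉-M : ¬ pow p (suc m) ≈ - natC (suc m)
        pᴹ≉-M pᴹ≈-M = n∤1+m (swapped-powers⇒∣ n (suc m) 2 (ℕ.s≤s⁻¹ (ℕ.≰⇒> k≰n))
                               (powers-of-negatives char0 n (suc m) pⁿ≈-n pᴹ≈-M))

    sparse-everywhere : ∀ k → SparseBelow n k f
    sparse-everywhere zero    _ ()
    sparse-everywhere (suc k) j j<1+k n∤j-1 with ℕ.m≤n⇒m<n∨m≡n (ℕ.s≤s⁻¹ j<1+k)
    ... | inj₁ j<k  = sparse-everywhere k j j<k n∤j-1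
    ... | inj₂ refl = next-vanishes k (sparse-everywhere k) n∤j-1

    off-class-vanishes : ∀ j → ¬ j % n ≡ 1 % n → f j ≈ 0#
    off-class-vanishes zero    _  = proj₁ norm
    off-class-vanishes (suc i) i+1≢1 =
      sparse-everywhere (suc (suc i)) (suc i) ℕ.≤-refl (λ n∣i → i+1≢1 (∣⇒suc≡1-mod n n∣i))

proposition1p2 : {c ℓ : Level} (F : Field c ℓ) → let open Field F in let open FPS F in
    CharZero →
    (n : ℕ) → .{{_ : NonZero n}} →
    (p : Carrier) → ¬ (p ≈ 0#) →
    (f : Series) → NormalizedSeries f →
    (∀ j → 2 ≤ j → j ≤ n → f j ≈ 0#) → ¬ (f (suc n) ≈ 0#) →
    (∀ k → 𝔗 f k ≈ scaleDiv p f k) →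
    ∀ j → ¬ (j % n ≡ 1 % n) → f j ≈ 0#
proposition1p2 F char0 (suc n′) p p≉0 f norm low f₁₊ₙ≉0 eqn =
  MainArgument.off-class-vanishes F char0 n′ p≉0 norm low f₁₊ₙ≉0 eqn
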